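{- (a) For any graph $G$ with $\left|\bigcap\mathcal C(G)\right|\ge|\mathcal C(G)|$, we have $G\cong T(G)^2\oplus K_r$, where $r:=\left|\bigcap\mathcal C(G)\right|-|\mathcal C(G)|$. (b) Let $G=H^2$ for some connected $3$-sun-free split graph $H=(C\cup I,E)$. Then $\left|\bigcap\mathcal C(G)\right|\ge|\mathcal C(G)|$ and $H$ contains $T(G)$ as an induced subgraph. Moreover, if $\left|\bigcap\mathcal C(G)\right|=|\mathcal C(G)|$, then $H\cong T(G)$.
   Context: All graphs are finite and simple. The square $H^2$ of a graph $H$ is obtained from $H$ by adding an edge between any two distinct vertices at distance exactly two in $H$. A split graph $H=(C\cup I,E)$ is a graph with vertex set partitioned into a clique $C$ and an independent set $I$. The $3$-sun consists of an independent set $\{u_1,u_2,u_3\}$ and a clique $\{v_1,v_2,v_3\}$ with $u_i$ adjacent exactly to $v_i$ and $v_{i+1}$ (indices mod 3). $\mathcal C(G)$ is the set of inclusion-maximal cliques of $G$ and $\bigcap\mathcal C(G)$ their common intersection. $G\oplus H$ is the join (disjoint union plus all edges between the two graphs); $K_r$ is the complete graph on $r$ vertices ($G\oplus K_0=G$). The trunk $T(G)$ of a graph $G$ is the split graph with vertex set $\mathcal C(G)\cup\big(V(G)\setminus\bigcap\mathcal C(G)\big)$ (one vertex for each maximal clique of $G$, together with the non-universal vertices of $G$), in which the vertices of $\mathcal C(G)$ form a clique, the vertices of $V(G)\setminus\bigcap\mathcal C(G)$ form an independent set, and a vertex $v\in V(G)\setminus\bigcap\mathcal C(G)$ is adjacent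 to $Q\in\mathcal C(G)$ if and only if $v\in Q$. -}

module Defs where

open import Data.Nat using (ℕ; zero; suc; _+_; _≤_)
open import Data.Bool using (Bool; true; false; not; _∧_; _∨_; T; if_then_else_)
open import Data.Bool.Properties using () renaming (_≟_ to _≟ᵇ_)
open import Data.Fin using (Fin; toℕ)
open import Data.Fin.Properties using () renaming (_≟_ to _≟ᶠ_)
open import Data.Vec using (Vec; []; _∷_; lookup)
open import Data.Vec.Properties using (≡-dec)
open import Data.List using (List; []; _∷_; _++_; map; allFin)
open import Data.Bool.ListAction using (all)
open import Data.Product using (Σ; _×_; ∃; proj₁)
open import Data.Sum using (_⊎_; inj₁; inj₂)
open import Data.Empty using (⊥)
open import Data.Unit using (⊤)
open import Relation.Nullary using (¬_)
open import Relation.Nullary.Decidable using (⌊_⌋)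
open import Relation.Binary.PropositionalEquality using (_≡_; _≢_; refl)
open import Function.Bundles using (_⇔_)

record Graph : Set₁ where
  field
    V : Set
    E : V → V → Set
open Graph public

record _≅_ (A B : Graph) : Set where
  field
    to      : V A → V B
    from    : V B → V A
    from-to : ∀ x → from (to x) ≡ x
    to-from : ∀ y → to (from y) ≡ y
    pres    : ∀ x y → E A x y ⇔ E B (to x) (to y)

InducedSubgraph : Graph → Graph → Set
InducedSubgraph A B =
  Σ (V A → V B) λ f → (∀ x y → f x ≡ f y → x ≡ y)
                    × (∀ x y → E A x y ⇔ E B (f x) (f y))

Square : Graph → Graph
Square A = record
  { V = V A
  ; E = λ x y → E A x y ⊎ (x ≢ y × (¬ E A x y) × ∃ λ z → E A x z × E A z y) }

JoinE : (A B : Graph) → V A ⊎ V B → V A ⊎ V B → Set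
JoinE A B (inj₁ x) (inj₁ y) = E A x y
JoinE A B (inj₂ x) (inj₂ y) = E B x y
JoinE A B (inj₁ _) (inj₂ _) = ⊤
JoinE A B (inj₂ _) (inj₁ _) = ⊤

_⊕_ : Graph → Graph → Graph
A ⊕ B = record { V = V A ⊎ V B ; E = JoinE A B }

K : ℕ → Graph
K r = record { V = Fin r ; E = λ x y → x ≢ y }

record FinGraph (n : ℕ) : Set where
  field
    adj     : Fin n → Fin n → Bool
    adj-sym : ∀ x y → adj x y ≡ adj y x
    adj-irr : ∀ x → adj x x ≡ false
open FinGraph public

toGraph : ∀ {n} → FinGraph n → Graph
toGraph {n} G = record { V = Fin n ; E = λ x y → T (adj G x y) }

Sub : ℕ → Set
Sub n = Vec Bool n

_∈ᵇ_ : ∀ {n} → Fin n → Sub n → Bool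
v ∈ᵇ Q = lookup Q v

-- Enumeration of all subsets of Fin n (each exactly once).
allSubs : ∀ n → List (Sub n)
allSubs zero = [] ∷ []
allSubs (suc n) = map (true ∷_) (allSubs n) ++ map (false ∷_) (allSubs n)

allV : ∀ {n} → (Fin n → Bool) → Bool
allV {n} p = all p (allFin n)

_⇒ᵇ_ : Bool → Bool → Bool
a ⇒ᵇ b = not a ∨ b

_≠ᶠ_ : ∀ {n} → Fin n → Fin n → Bool
x ≠ᶠ y = not ⌊ x ≟ᶠ y ⌋

_⊆ᵇ_ : ∀ {n} → Sub n → Sub n → Bool
Q ⊆ᵇ Q' = allV λ x → (x ∈ᵇ Q) ⇒ᵇ (x ∈ᵇ Q')

_==ˢ_ : ∀ {n} → Sub n → Sub n → Bool
Q ==ˢ Q' = ⌊ ≡-dec _≟ᵇ_ Q Q' ⌋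

isClique : ∀ {n} → FinGraph n → Sub n → Bool
isClique G Q = allV λ x → allV λ y →
  (x ∈ᵇ Q ∧ y ∈ᵇ Q ∧ x ≠ᶠ y) ⇒ᵇ adj G x y

isMaxClique : ∀ {n} → FinGraph n → Sub n → Bool
isMaxClique {n} G Q = isClique G Q ∧
  all (λ Q' → (isClique G Q' ∧ (Q ⊆ᵇ Q')) ⇒ᵇ (Q' ==ˢ Q)) (allSubs n)

inAllMax : ∀ {n} → FinGraph n → Fin n → Bool
inAllMax {n} G v = all (λ Q → isMaxClique G Q ⇒ᵇ (v ∈ᵇ Q)) (allSubs n)

count : ∀ {A : Set} → (A → Bool) → List A → ℕ
count p [] = 0
count p (x ∷ xs) = (if p x then 1 else 0) + count p xs

numMaxCliques : ∀ {n} → FinGraph n → ℕ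
numMaxCliques {n} G = count (isMaxClique G) (allSubs n)

interSize : ∀ {n} → FinGraph n → ℕ
interSize {n} G = count (inAllMax G) (allFin n)

MaxClique : ∀ {n} → FinGraph n → Set
MaxClique {n} G = Σ (Sub n) λ Q → T (isMaxClique G Q)

NonCore : ∀ {n} → FinGraph n → Set
NonCore {n} G = Σ (Fin n) λ v → T (not (inAllMax G v))

TrunkE : ∀ {n} (G : FinGraph n) → MaxClique G ⊎ NonCore G → MaxClique G ⊎ NonCore G → Set
TrunkE G (inj₁ Q) (inj₁ Q') = proj₁ Q ≢ proj₁ Q'
TrunkE G (inj₁ Q) (inj₂ v)  = T (proj₁ v ∈ᵇ proj₁ Q)
TrunkE G (inj₂ v) (inj₁ Q)  = T (proj₁ v ∈ᵇ proj₁ Q)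
TrunkE G (inj₂ _) (inj₂ _)  = ⊥

Trunk : ∀ {n} → FinGraph n → Graph
Trunk G = record { V = MaxClique G ⊎ NonCore G ; E = TrunkE G }

-- The 3-sun: vertices 0,1,2 are u1,u2,u3 (independent), 3,4,5 are v1,v2,v3
-- (clique); u_i ~ v_i, v_{i+1} (indices mod 3).
sunEdge : ℕ → ℕ → Bool
sunEdge 0 3 = true
sunEdge 0 4 = true
sunEdge 1 4 = true
sunEdge 1 5 = true
sunEdge 2 5 = true
sunEdge 2 3 = true
sunEdge 3 4 = true
sunEdge 3 5 = true
sunEdge 4 5 = true
sunEdge _ _ = false

Sun3 : Graph
Sun3 = record { V = Fin 6 ; E = λ x y → T (sunEdge (toℕ x) (toℕ y) ∨ sunEdge (toℕ y) (toℕ x)) }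

IsSplit : ∀ {n} → FinGraph n → Set
IsSplit {n} H = Σ (Sub n) λ C →
    (∀ x y → T (x ∈ᵇ C) → T (y ∈ᵇ C) → x ≢ y → T (adj H x y))
  × (∀ x y → T (not (x ∈ᵇ C)) → T (not (y ∈ᵇ C)) → ¬ T (adj H x y))

data Reach {n} (H : FinGraph n) (x : Fin n) : Fin n → Set where
  here : Reach H x x
  step : ∀ {y z} → Reach H x y → T (adj H y z) → Reach H x z

Connected : ∀ {n} → FinGraph n → Set
Connected {n} H = (1 ≤ n) × (∀ x y → Reach H x y)

SunFree : ∀ {n} → FinGraph n → Set
SunFree H = ¬ InducedSubgraph Sun3 (toGraph H)

-- The vertices of ⋂𝒞(G) are exactly the universal vertices of G, and two other
-- vertices are adjacent iff they share a maximal clique. In T(G)² every clique vertex is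
-- universal, since each non-universal vertex lies in some maximal clique, and two non-universal
-- vertices are adjacent iff they have a common clique vertex as neighbour in T(G). So G and
-- T(G)² ⊕ K_r are both a universal part joined to the same graph on V(G) ∖ ⋂𝒞(G), and r is
-- chosen to make the universal parts equinumerous.
--
-- In G = H² each vertex of C is universal, and two vertices of I are adjacent iff they
-- have a common neighbour in C. 3-sun-freeness gives a Helly property for the C-neighbourhoods
-- of vertices of I, so every maximal clique Q of G has a centre c ∈ C adjacent in H to all of
-- Q ∩ I, and then Q = C ∪ N_H(c). Mapping each maximal clique to its centre and each
-- non-universal vertex to itself embeds T(G) into H as an induced subgraph; the centres lie in
-- C ⊆ ⋂𝒞(G), which gives the inequality, and equality makes the embedding surjective.

module Submission where

open import Defs
open import Data.Bool using (Bool; true; false; not; _∨_; T; if_then_else_)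
open import Data.Bool.Properties using (T-∧; T-∨; T-irrelevant)
open import Data.Empty using (⊥; ⊥-elim)
open import Data.Fin using (Fin; zero; suc; toℕ; punchOut)
open import Data.Fin.Patterns using (0F; 1F; 2F; 3F; 4F; 5F)
open import Data.Fin.Properties using (+↔⊎; any?; injective⇒≤; punchOut-injective)
  renaming (_≟_ to _≟ᶠ_)
open import Data.List using (List; []; _∷_; _++_; map; allFin; tabulate; filter; foldl)
open import Data.List.Membership.Propositional using (_∈_)
open import Data.List.Membership.Propositional.Properties
  using (∈-allFin; ∈-++⁺ˡ; ∈-++⁺ʳ; ∈-map⁺; ∈-filter⁺; ∈-filter⁻)
open import Data.List.Relation.Unary.All as All using (All; []; _∷_)
open import Data.List.Relation.Unary.All.Properties using (all⁺; all⁻)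
open import Data.List.Relation.Unary.Any using (here; there)
open import Data.Bool.ListAction using (all)
open import Data.Nat using (ℕ; zero; suc; _+_; _≤_; _∸_)
open import Data.Nat.Properties using (m+[n∸m]≡n; +-identityʳ; +-assoc; <-irrefl)
open import Data.Product using (Σ; _×_; ∃; proj₁; proj₂; _,_)
open import Data.Sum using (_⊎_; inj₁; inj₂)
open import Data.Sum.Function.Propositional using (_⊎-↔_)
open import Data.Unit using (⊤; tt)
open import Data.Vec using ([]; _∷_; lookup; replicate; _[_]≔_) renaming (tabulate to tabulateᵛ)
open import Data.Vec.Properties
  using (lookup∘update; lookup∘update′; lookup-replicate; lookup∘tabulate; tabulate∘lookup; tabulate-cong)
open import Function using (_∘_; _↔_; Inverse; mk↔ₛ′; _⇔_; mk⇔; Equivalence; Injection)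
open import Function.Definitions using (Injective)
open import Function.Properties.Inverse using (↔-refl; ↔-sym; ↔-trans; ↔⇒↣)
import Function.Properties.Equivalence as ⇔
open Equivalence using (to; from)
open import Relation.Nullary using (¬_; Dec; yes; no; _×-dec_; ¬?)
open import Relation.Nullary.Decidable using (⌊_⌋; T?; toWitness; fromWitness)
open import Relation.Binary.PropositionalEquality
  using (_≡_; _≢_; refl; sym; trans; cong; cong₂; subst; subst₂)

T-or-T-not : ∀ b → T b ⊎ T (not b)
T-or-T-not true = inj₁ tt
T-or-T-not false = inj₂ tt

T-not⇔¬ : ∀ {b} → T (not b) ⇔ (¬ T b)
T-not⇔¬ {true} = mk⇔ (λ ()) (λ ¬t → ¬t tt)
T-not⇔¬ {false} = mk⇔ (λ _ ()) (λ _ → tt)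

T-⇒ᵇ : ∀ {a b} → T (a ⇒ᵇ b) ⇔ (T a → T b)
T-⇒ᵇ {true} = mk⇔ (λ t _ → t) (λ f → f tt)
T-⇒ᵇ {false} = mk⇔ (λ _ ()) (λ _ → tt)

T-≠ᶠ : ∀ {n} {x y : Fin n} → T (x ≠ᶠ y) ⇔ (x ≢ y)
T-≠ᶠ = mk⇔ (λ t x≡y → to T-not⇔¬ t (fromWitness x≡y))
           (λ x≢y → from T-not⇔¬ (x≢y ∘ toWitness))

T-injective : ∀ {a b} → T a ⇔ T b → a ≡ b
T-injective {true} {true} _ = refl
T-injective {true} {false} a⇔b = ⊥-elim (to a⇔b tt)
T-injective {false} {true} a⇔b = ⊥-elim (from a⇔b tt)
T-injective {false} {false} _ = refl

Σ-T-≡ : ∀ {A : Set} {p : A → Bool} {a b : Σ A (T ∘ p)} → proj₁ a ≡ proj₁ b → a ≡ b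
Σ-T-≡ {a = x , s} {.x , t} refl = cong (x ,_) (T-irrelevant s t)

T-all-complete : ∀ {A : Set} {p : A → Bool} {xs : List A} →
                 (∀ x → x ∈ xs) → T (all p xs) ⇔ (∀ x → T (p x))
T-all-complete {p = p} {xs} complete =
  mk⇔ (λ t x → All.lookup (all⁺ p xs t) (complete x)) (λ h → all⁻ p (All.tabulate {xs = xs} (λ {x} _ → h x)))

T-allV : ∀ {n} {p : Fin n → Bool} → T (allV p) ⇔ (∀ x → T (p x))
T-allV = T-all-complete ∈-allFin

infix 4 _∈ₛ_ _∉ₛ_ _⊆ₛ_

_∈ₛ_ : ∀ {n} → Fin n → Sub n → Set
x ∈ₛ Q = T (x ∈ᵇ Q)

_∉ₛ_ : ∀ {n} → Fin n → Sub n → Set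
x ∉ₛ Q = ¬ x ∈ₛ Q

_⊆ₛ_ : ∀ {n} → Sub n → Sub n → Set
Q ⊆ₛ Q' = ∀ {x} → x ∈ₛ Q → x ∈ₛ Q'

∈-allSubs : ∀ {n} (Q : Sub n) → Q ∈ allSubs n
∈-allSubs {zero} [] = here refl
∈-allSubs {suc n} (true ∷ Q) = ∈-++⁺ˡ (∈-map⁺ (true ∷_) (∈-allSubs Q))
∈-allSubs {suc n} (false ∷ Q) =
  ∈-++⁺ʳ (map (true ∷_) (allSubs n)) (∈-map⁺ (false ∷_) (∈-allSubs Q))

T-allSubs : ∀ {n} {p : Sub n → Bool} → T (all p (allSubs n)) ⇔ (∀ Q → T (p Q))
T-allSubs = T-all-complete ∈-allSubs

T-⊆ᵇ : ∀ {n} {Q Q' : Sub n} → T (Q ⊆ᵇ Q') ⇔ Q ⊆ₛ Q'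
T-⊆ᵇ = mk⇔ (λ t {x} → to T-⇒ᵇ (to T-allV t x))
            (λ Q⊆Q' → from T-allV (λ x → from T-⇒ᵇ (Q⊆Q' {x})))

T-==ˢ : ∀ {n} {Q Q' : Sub n} → T (Q ==ˢ Q') ⇔ Q ≡ Q'
T-==ˢ = mk⇔ toWitness fromWitness

Sub-ext : ∀ {n} {Q Q' : Sub n} → (∀ x → x ∈ₛ Q ⇔ x ∈ₛ Q') → Q ≡ Q'
Sub-ext {Q = Q} {Q'} same =
  trans (sym (tabulate∘lookup Q)) (trans (tabulate-cong (T-injective ∘ same)) (tabulate∘lookup Q'))

∈-insert-self : ∀ {n} (Q : Sub n) x → x ∈ₛ (Q [ x ]≔ true)
∈-insert-self Q x = subst T (sym (lookup∘update x Q true)) tt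

∈-insert⁺ : ∀ {n} (Q : Sub n) x {y} → y ∈ₛ Q → y ∈ₛ (Q [ x ]≔ true)
∈-insert⁺ Q x {y} y∈Q with y ≟ᶠ x
... | yes refl = ∈-insert-self Q x
... | no y≢x = subst T (sym (lookup∘update′ y≢x Q true)) y∈Q

∈-insert⁻ : ∀ {n} (Q : Sub n) x {y} → y ∈ₛ (Q [ x ]≔ true) → y ≡ x ⊎ y ∈ₛ Q
∈-insert⁻ Q x {y} y∈Q+x with y ≟ᶠ x
... | yes y≡x = inj₁ y≡x
... | no y≢x = inj₂ (subst T (lookup∘update′ y≢x Q true) y∈Q+x)

-- Counting by bijections with Fin

Fin-cong : ∀ {a b} → a ≡ b → Fin a ↔ Fin b
Fin-cong refl = ↔-refl

T↔Fin : ∀ b → T b ↔ Fin (if b then 1 else 0)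
T↔Fin true = mk↔ₛ′ (λ _ → zero) (λ _ → tt) (λ { zero → refl }) (λ _ → refl)
T↔Fin false = mk↔ₛ′ (λ ()) (λ ()) (λ ()) (λ ())

Σ-Fin-suc↔ : ∀ {n} {P : Fin (suc n) → Set} → Σ (Fin (suc n)) P ↔ (P zero ⊎ Σ (Fin n) (P ∘ suc))
Σ-Fin-suc↔ = mk↔ₛ′
  (λ { (zero , p) → inj₁ p ; (suc i , p) → inj₂ (i , p) })
  (λ { (inj₁ p) → zero , p ; (inj₂ (i , p)) → suc i , p })
  (λ { (inj₁ p) → refl ; (inj₂ (i , p)) → refl })
  (λ { (zero , p) → refl ; (suc i , p) → refl })

Σ-Sub-suc↔ : ∀ {n} {P : Sub (suc n) → Set} →
             Σ (Sub (suc n)) P ↔ (Σ (Sub n) (P ∘ (true ∷_)) ⊎ Σ (Sub n) (P ∘ (false ∷_)))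
Σ-Sub-suc↔ = mk↔ₛ′
  (λ { (true ∷ Q , p) → inj₁ (Q , p) ; (false ∷ Q , p) → inj₂ (Q , p) })
  (λ { (inj₁ (Q , p)) → true ∷ Q , p ; (inj₂ (Q , p)) → false ∷ Q , p })
  (λ { (inj₁ (Q , p)) → refl ; (inj₂ (Q , p)) → refl })
  (λ { (true ∷ Q , p) → refl ; (false ∷ Q , p) → refl })

Σ-Sub-zero↔ : ∀ {P : Sub zero → Set} → Σ (Sub zero) P ↔ P []
Σ-Sub-zero↔ = mk↔ₛ′ (λ { ([] , p) → p }) ([] ,_) (λ _ → refl) (λ { ([] , p) → refl })

count-++ : ∀ {A : Set} (p : A → Bool) xs ys → count p (xs ++ ys) ≡ count p xs + count p ys
count-++ p [] ys = refl
count-++ p (x ∷ xs) ys =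
  trans (cong ((if p x then 1 else 0) +_) (count-++ p xs ys)) (sym (+-assoc (if p x then 1 else 0) _ _))

count-map : ∀ {A B : Set} (p : B → Bool) (f : A → B) xs → count p (map f xs) ≡ count (p ∘ f) xs
count-map p f [] = refl
count-map p f (x ∷ xs) = cong ((if p (f x) then 1 else 0) +_) (count-map p f xs)

Σ-T-tabulate↔ : ∀ {A : Set} n (f : Fin n → A) (p : A → Bool) →
                Σ (Fin n) (T ∘ p ∘ f) ↔ Fin (count p (tabulate f))
Σ-T-tabulate↔ zero f p = mk↔ₛ′ (λ { (() , _) }) (λ ()) (λ ()) (λ { (() , _) })
Σ-T-tabulate↔ (suc n) f p =
  ↔-trans Σ-Fin-suc↔ (↔-trans (T↔Fin (p (f zero)) ⊎-↔ Σ-T-tabulate↔ n (f ∘ suc) p) (↔-sym +↔⊎))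

Σ-T-allSubs↔ : ∀ n (p : Sub n → Bool) → Σ (Sub n) (T ∘ p) ↔ Fin (count p (allSubs n))
Σ-T-allSubs↔ zero p = ↔-trans Σ-Sub-zero↔ (↔-trans (T↔Fin (p [])) (Fin-cong (sym (+-identityʳ _))))
Σ-T-allSubs↔ (suc n) p =
  ↔-trans Σ-Sub-suc↔
    (↔-trans (Σ-T-allSubs↔ n (p ∘ (true ∷_)) ⊎-↔ Σ-T-allSubs↔ n (p ∘ (false ∷_)))
      (↔-trans (↔-sym +↔⊎) (Fin-cong (sym count-allSubs))))
  where
  count-allSubs : count p (allSubs (suc n)) ≡
                  count (p ∘ (true ∷_)) (allSubs n) + count (p ∘ (false ∷_)) (allSubs n)
  count-allSubs = trans (count-++ p (map (true ∷_) (allSubs n)) (map (false ∷_) (allSubs n)))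
    (cong₂ _+_
      (count-map p (true ∷_) (allSubs n)) (count-map p (false ∷_) (allSubs n)))

Fin-injective⇒surjective : ∀ {k} {g : Fin k → Fin k} → Injective _≡_ _≡_ g → ∀ y → ∃ λ x → g x ≡ y
Fin-injective⇒surjective {suc k} {g} g-inj y with any? (λ x → g x ≟ᶠ y)
... | yes hit = hit
... | no miss = ⊥-elim (<-irrefl refl (injective⇒≤ {f = squeeze} squeeze-injective))
  where
  g≢y : ∀ x → y ≢ g x
  g≢y x y≡gx = miss (x , sym y≡gx)
  squeeze : Fin (suc k) → Fin k
  squeeze x = punchOut (g≢y x)
  squeeze-injective : Injective _≡_ _≡_ squeeze
  squeeze-injective {x} {x'} e = g-inj (punchOut-injective (g≢y x) (g≢y x') e)

module _ {A B : Set} {g : A → B} (g-inj : Injective _≡_ _≡_ g) where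

  private
    transported-injective : ∀ {a b} (A↔ : A ↔ Fin a) (B↔ : B ↔ Fin b) →
                            Injective _≡_ _≡_ (Inverse.to B↔ ∘ g ∘ Inverse.from A↔)
    transported-injective A↔ B↔ e =
      Injection.injective (↔⇒↣ (↔-sym A↔)) (g-inj (Injection.injective (↔⇒↣ B↔) e))

  ↔-injective⇒≤ : ∀ {a b} → A ↔ Fin a → B ↔ Fin b → a ≤ b
  ↔-injective⇒≤ A↔ B↔ = injective⇒≤ (transported-injective A↔ B↔)

  ↔-injective⇒surjective : ∀ {k} → A ↔ Fin k → B ↔ Fin k → ∀ y → ∃ λ x → g x ≡ y
  ↔-injective⇒surjective A↔ B↔ y with Fin-injective⇒surjective (transported-injective A↔ B↔) (Inverse.to B↔ y)
  ... | i , e = Inverse.from A↔ i , Injection.injective (↔⇒↣ B↔) e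

module _ {A : Set} (p : A → Bool) where

  private
    classify : ∀ x → T (p x) ⊎ T (not (p x)) → Σ A (T ∘ p) ⊎ Σ A (T ∘ not ∘ p)
    classify x (inj₁ t) = inj₁ (x , t)
    classify x (inj₂ t) = inj₂ (x , t)

    unclassify : Σ A (T ∘ p) ⊎ Σ A (T ∘ not ∘ p) → A
    unclassify (inj₁ (x , _)) = x
    unclassify (inj₂ (x , _)) = x

  partition : A → Σ A (T ∘ p) ⊎ Σ A (T ∘ not ∘ p)
  partition x = classify x (T-or-T-not (p x))

  partition-yes : ∀ {x} (t : T (p x)) → partition x ≡ inj₁ (x , t)
  partition-yes {x} t with T-or-T-not (p x)
  ... | inj₁ t' = cong (λ s → inj₁ (x , s)) (T-irrelevant t' t)
  ... | inj₂ f = ⊥-elim (to T-not⇔¬ f t)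

  partition-no : ∀ {x} (f : T (not (p x))) → partition x ≡ inj₂ (x , f)
  partition-no {x} f with T-or-T-not (p x)
  ... | inj₁ t = ⊥-elim (to T-not⇔¬ f t)
  ... | inj₂ f' = cong (λ s → inj₂ (x , s)) (T-irrelevant f' f)

  ↔-partition : A ↔ (Σ A (T ∘ p) ⊎ Σ A (T ∘ not ∘ p))
  ↔-partition = mk↔ₛ′ partition unclassify
    (λ { (inj₁ (x , t)) → partition-yes t ; (inj₂ (x , f)) → partition-no f })
    (λ x → unclassify-classify x (T-or-T-not (p x)))
    where
    unclassify-classify : ∀ x d → unclassify (classify x d) ≡ x
    unclassify-classify x (inj₁ _) = refl
    unclassify-classify x (inj₂ _) = refl

-- Simple graphs, universal vertices and embeddings

IsSimple : Graph → Set
IsSimple A = (∀ x → ¬ E A x x) × (∀ {x y} → E A x y → E A y x)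

Universal : (A : Graph) → V A → Set
Universal A x = ∀ {y} → x ≢ y → E A x y

TwinFree : Graph → Set
TwinFree A = ∀ {x y} → (∀ z → E A x z ⇔ E A y z) → x ≡ y

toGraph-simple : ∀ {n} (G : FinGraph n) → IsSimple (toGraph G)
toGraph-simple G = (λ x → subst T (adj-irr G x)) , λ {x} {y} → subst T (adj-sym G x y)

square-simple : ∀ {A} → IsSimple A → IsSimple (Square A)
square-simple (irr , symm) =
    (λ { x (inj₁ xx) → irr x xx ; x (inj₂ (x≢x , _)) → x≢x refl })
  , λ { (inj₁ xy) → inj₁ (symm xy)
      ; (inj₂ (x≢y , ¬xy , z , xz , zy)) → inj₂ (x≢y ∘ sym , ¬xy ∘ symm , z , symm zy , symm xz) }

⊕-simple : ∀ {A B} → IsSimple A → IsSimple B → IsSimple (A ⊕ B)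
⊕-simple {A} {B} (irrA , symA) (irrB , symB) = irr , λ {x} {y} → symm {x} {y}
  where
  irr : ∀ x → ¬ JoinE A B x x
  irr (inj₁ x) = irrA x
  irr (inj₂ x) = irrB x
  symm : ∀ {x y} → JoinE A B x y → JoinE A B y x
  symm {inj₁ _} {inj₁ _} = symA
  symm {inj₁ _} {inj₂ _} _ = tt
  symm {inj₂ _} {inj₁ _} _ = tt
  symm {inj₂ _} {inj₂ _} = symB

K-simple : ∀ r → IsSimple (K r)
K-simple r = (λ x x≢x → x≢x refl) , λ x≢y → x≢y ∘ sym

Trunk-simple : ∀ {n} (G : FinGraph n) → IsSimple (Trunk G)
Trunk-simple G = irr , λ {x} {y} → symm {x} {y}
  where
  irr : ∀ x → ¬ TrunkE G x x
  irr (inj₁ Q) Q≢Q = Q≢Q refl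
  irr (inj₂ v) ()
  symm : ∀ {x y} → TrunkE G x y → TrunkE G y x
  symm {inj₁ _} {inj₁ _} Q≢Q' = Q≢Q' ∘ sym
  symm {inj₁ _} {inj₂ _} v∈Q = v∈Q
  symm {inj₂ _} {inj₁ _} v∈Q = v∈Q

⊕-universalˡ : ∀ {A B x} → Universal A x → Universal (A ⊕ B) (inj₁ x)
⊕-universalˡ ux {inj₁ y} x≢y = ux (x≢y ∘ cong inj₁)
⊕-universalˡ ux {inj₂ y} _ = tt

⊕-universalʳ : ∀ {A B x} → Universal B x → Universal (A ⊕ B) (inj₂ x)
⊕-universalʳ ux {inj₁ y} _ = tt
⊕-universalʳ ux {inj₂ y} x≢y = ux (x≢y ∘ cong inj₂)

K-universal : ∀ {r} (i : Fin r) → Universal (K r) i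
K-universal i i≢j = i≢j

universal-adj⇔≢ : ∀ {A x} → IsSimple A → Universal A x → ∀ y → E A x y ⇔ x ≢ y
universal-adj⇔≢ (irr , _) ux y = mk⇔ (λ { xy refl → irr _ xy }) ux

module _ {A B : Graph} (simpleA : IsSimple A) (simpleB : IsSimple B)
         (f : V A → V B) (f-inj : Injective _≡_ _≡_ f) (u : V A → Bool)
         (univ : ∀ {x} → T (u x) → Universal A x × Universal B (f x)) where

  private
    adjacency-at-universal : ∀ {x} → T (u x) → ∀ y → E A x y ⇔ E B (f x) (f y)
    adjacency-at-universal ux y =
      ⇔.trans (universal-adj⇔≢ simpleA (proj₁ (univ ux)) y)
        (⇔.trans (mk⇔ (λ x≢y → x≢y ∘ f-inj) (λ fx≢fy → fx≢fy ∘ cong f))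
          (⇔.sym (universal-adj⇔≢ simpleB (proj₂ (univ ux)) (f y))))

  adjacency-via-universal :
    (∀ {x y} → T (not (u x)) → T (not (u y)) → E A x y ⇔ E B (f x) (f y)) →
    ∀ x y → E A x y ⇔ E B (f x) (f y)
  adjacency-via-universal rest x y with T-or-T-not (u x) | T-or-T-not (u y)
  ... | inj₁ ux | _ = adjacency-at-universal ux y
  ... | inj₂ _ | inj₁ uy =
    ⇔.trans (mk⇔ (proj₂ simpleA) (proj₂ simpleA))
      (⇔.trans (adjacency-at-universal uy x) (mk⇔ (proj₂ simpleB) (proj₂ simpleB)))
  ... | inj₂ ux | inj₂ uy = rest ux uy

≅-from-↔ : ∀ {A B} (σ : V A ↔ V B) →
           (∀ x y → E A x y ⇔ E B (Inverse.to σ x) (Inverse.to σ y)) → A ≅ B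
≅-from-↔ σ pres = record
  { to = Inverse.to σ ; from = Inverse.from σ
  ; from-to = Inverse.strictlyInverseʳ σ ; to-from = Inverse.strictlyInverseˡ σ ; pres = pres }

twinFree-embedding : ∀ {A B} → TwinFree A → (f : V A → V B) →
                     (∀ x y → E A x y ⇔ E B (f x) (f y)) → InducedSubgraph A B
twinFree-embedding {A} {B} twinFree f pres = f , f-injective , pres
  where
  f-injective : ∀ x y → f x ≡ f y → x ≡ y
  f-injective x y fx≡fy = twinFree λ z →
    ⇔.trans (pres x z) (subst (λ w → E B w (f z) ⇔ E A y z) (sym fx≡fy) (⇔.sym (pres y z)))

surjective-embedding⇒≅ : ∀ {A B} (emb : InducedSubgraph A B) →
                         (∀ y → ∃ λ x → proj₁ emb x ≡ y) → B ≅ A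
surjective-embedding⇒≅ {A} {B} (f , f-inj , pres) surj = record
  { to = g ; from = f ; from-to = f∘g ; to-from = λ x → f-inj (g (f x)) x (f∘g (f x))
  ; pres = λ y y' → subst₂ (λ w w' → E B w w' ⇔ E A (g y) (g y')) (f∘g y) (f∘g y')
                             (⇔.sym (pres (g y) (g y'))) }
  where
  g : V B → V A
  g y = proj₁ (surj y)
  f∘g : ∀ y → f (g y) ≡ y
  f∘g y = proj₂ (surj y)

-- Maximal cliques of a finite graph

module Cliques {n} (G : FinGraph n) where

  Adj : Fin n → Fin n → Set
  Adj x y = E (toGraph G) x y

  adj-symmetric : ∀ {x y} → Adj x y → Adj y x
  adj-symmetric = proj₂ (toGraph-simple G)

  adj⇒≢ : ∀ {x y} → Adj x y → x ≢ y
  adj⇒≢ xy refl = proj₁ (toGraph-simple G) _ xy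

  IsClique : Sub n → Set
  IsClique Q = ∀ {x y} → x ∈ₛ Q → y ∈ₛ Q → x ≢ y → Adj x y

  IsMaxClique : Sub n → Set
  IsMaxClique Q = IsClique Q × (∀ {Q'} → IsClique Q' → Q ⊆ₛ Q' → Q' ≡ Q)

  T-isClique : ∀ {Q} → T (isClique G Q) ⇔ IsClique Q
  T-isClique {Q} = mk⇔
    (λ t {x} {y} x∈Q y∈Q x≢y → to T-⇒ᵇ (to T-allV (to T-allV t x) y)
       (from (T-∧ {x ∈ᵇ Q}) (x∈Q , from (T-∧ {y ∈ᵇ Q}) (y∈Q , from T-≠ᶠ x≢y))))
    (λ clique → from T-allV λ x → from T-allV λ y → from T-⇒ᵇ λ t →
       let x∈Q , rest = to (T-∧ {x ∈ᵇ Q}) t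
           y∈Q , x≠y = to (T-∧ {y ∈ᵇ Q}) rest
       in clique x∈Q y∈Q (to T-≠ᶠ x≠y))

  T-isMaxClique : ∀ {Q} → T (isMaxClique G Q) ⇔ IsMaxClique Q
  T-isMaxClique {Q} = mk⇔ reflect reify
    where
    reflect : T (isMaxClique G Q) → IsMaxClique Q
    reflect t = to (T-isClique {Q}) clique , maximal
      where
      clique = proj₁ (to (T-∧ {isClique G Q}) t)
      maximal : ∀ {Q'} → IsClique Q' → Q ⊆ₛ Q' → Q' ≡ Q
      maximal {Q'} clique' Q⊆Q' = to T-==ˢ (to T-⇒ᵇ (to T-allSubs (proj₂ (to (T-∧ {isClique G Q}) t)) Q')
        (from (T-∧ {isClique G Q'}) (from (T-isClique {Q'}) clique' , from (T-⊆ᵇ {Q = Q} {Q'}) Q⊆Q')))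
    reify : IsMaxClique Q → T (isMaxClique G Q)
    reify (clique , maximal) = from (T-∧ {isClique G Q}) (from (T-isClique {Q}) clique ,
      from T-allSubs λ Q' → from T-⇒ᵇ λ t →
        let clique' , Q⊆Q' = to (T-∧ {isClique G Q'}) t in
        from T-==ˢ (maximal (to (T-isClique {Q'}) clique') (to (T-⊆ᵇ {Q = Q} {Q'}) Q⊆Q')))

  T-inAllMax : ∀ {v} → T (inAllMax G v) ⇔ (∀ {Q} → IsMaxClique Q → v ∈ₛ Q)
  T-inAllMax {v} = mk⇔ reflect reify
    where
    reflect : T (inAllMax G v) → ∀ {Q} → IsMaxClique Q → v ∈ₛ Q
    reflect t {Q} maxQ = to T-⇒ᵇ (to T-allSubs t Q) (from T-isMaxClique maxQ)
    reify : (∀ {Q} → IsMaxClique Q → v ∈ₛ Q) → T (inAllMax G v)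
    reify inAll = from T-allSubs λ Q → from T-⇒ᵇ λ t → inAll {Q} (to (T-isMaxClique {Q}) t)

  maxClique-absorbs : ∀ {Q} → IsMaxClique Q → ∀ {x} → (∀ {y} → y ∈ₛ Q → x ≢ y → Adj x y) → x ∈ₛ Q
  maxClique-absorbs {Q} (clique , maximal) {x} adjacent =
    subst (λ R → x ∈ₛ R) (maximal {Q [ x ]≔ true} clique+x (∈-insert⁺ Q x)) (∈-insert-self Q x)
    where
    clique+x : IsClique (Q [ x ]≔ true)
    clique+x {u} {v} u∈ v∈ u≢v with ∈-insert⁻ Q x u∈ | ∈-insert⁻ Q x v∈
    ... | inj₁ refl | inj₁ refl = ⊥-elim (u≢v refl)
    ... | inj₁ refl | inj₂ v∈Q = adjacent v∈Q u≢v
    ... | inj₂ u∈Q | inj₁ refl = adj-symmetric (adjacent u∈Q (u≢v ∘ sym))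
    ... | inj₂ u∈Q | inj₂ v∈Q = clique u∈Q v∈Q u≢v

  private
    insertIfClique : Sub n → Fin n → Sub n
    insertIfClique Q v = if isClique G (Q [ v ]≔ true) then Q [ v ]≔ true else Q

    greedy : Sub n → List (Fin n) → Sub n
    greedy = foldl insertIfClique

    insertIfClique-clique : ∀ {Q} v → IsClique Q → IsClique (insertIfClique Q v)
    insertIfClique-clique {Q} v clique with isClique G (Q [ v ]≔ true) in accepted
    ... | true = to (T-isClique {Q [ v ]≔ true}) (subst T (sym accepted) tt)
    ... | false = clique

    insertIfClique-⊇ : ∀ Q v → Q ⊆ₛ insertIfClique Q v
    insertIfClique-⊇ Q v with isClique G (Q [ v ]≔ true)
    ... | true = ∈-insert⁺ Q v
    ... | false = λ x∈Q → x∈Q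

    greedy-clique : ∀ {Q} vs → IsClique Q → IsClique (greedy Q vs)
    greedy-clique [] clique = clique
    greedy-clique (v ∷ vs) clique = greedy-clique vs (insertIfClique-clique v clique)

    greedy-⊇ : ∀ Q vs → Q ⊆ₛ greedy Q vs
    greedy-⊇ Q [] x∈Q = x∈Q
    greedy-⊇ Q (v ∷ vs) x∈Q = greedy-⊇ (insertIfClique Q v) vs (insertIfClique-⊇ Q v x∈Q)

    greedy-decided : ∀ Q vs {v} → v ∈ vs →
                     v ∈ₛ greedy Q vs ⊎ Σ (Sub n) λ P → P ⊆ₛ greedy Q vs × ¬ IsClique (P [ v ]≔ true)
    greedy-decided Q (v ∷ vs) (here refl) with isClique G (Q [ v ]≔ true) in accepted
    ... | true = inj₁ (greedy-⊇ (Q [ v ]≔ true) vs (∈-insert-self Q v))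
    ... | false = inj₂ (Q , greedy-⊇ Q vs , λ clique → subst T accepted (from (T-isClique {Q [ v ]≔ true}) clique))
    greedy-decided Q (w ∷ vs) (there v∈vs) = greedy-decided (insertIfClique Q w) vs v∈vs

  extend-to-maxClique : ∀ {Q} → IsClique Q → Σ (Sub n) λ M → IsMaxClique M × Q ⊆ₛ M
  extend-to-maxClique {Q} clique = M , (greedy-clique (allFin n) clique , maximal) , greedy-⊇ Q (allFin n)
    where
    M : Sub n
    M = greedy Q (allFin n)
    maximal : ∀ {Q'} → IsClique Q' → M ⊆ₛ Q' → Q' ≡ M
    maximal {Q'} clique' M⊆Q' = Sub-ext λ x → mk⇔ (Q'⊆M x) M⊆Q'
      where
      Q'⊆M : ∀ x → x ∈ₛ Q' → x ∈ₛ M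
      Q'⊆M x x∈Q' with greedy-decided Q (allFin n) (∈-allFin x)
      ... | inj₁ x∈M = x∈M
      ... | inj₂ (P , P⊆M , rejected) = ⊥-elim (rejected λ u∈ v∈ → clique' (⊆Q' u∈) (⊆Q' v∈))
        where
        ⊆Q' : P [ x ]≔ true ⊆ₛ Q'
        ⊆Q' u∈ with ∈-insert⁻ P x u∈
        ... | inj₁ refl = x∈Q'
        ... | inj₂ u∈P = M⊆Q' (P⊆M u∈P)

  private
    pair : Fin n → Fin n → Sub n
    pair x y = (replicate n false [ x ]≔ true) [ y ]≔ true

    ∈-pair⁻ : ∀ {x y u} → u ∈ₛ pair x y → u ≡ x ⊎ u ≡ y
    ∈-pair⁻ {x} {y} u∈ with ∈-insert⁻ (replicate n false [ x ]≔ true) y u∈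
    ... | inj₁ u≡y = inj₂ u≡y
    ... | inj₂ u∈ with ∈-insert⁻ (replicate n false) x u∈
    ...   | inj₁ u≡x = inj₁ u≡x
    ...   | inj₂ u∈∅ = ⊥-elim (subst T (lookup-replicate {n = n} _ false) u∈∅)

  maxClique-containing : ∀ x y → (x ≢ y → Adj x y) → Σ (Sub n) λ M → IsMaxClique M × x ∈ₛ M × y ∈ₛ M
  maxClique-containing x y adjacent with extend-to-maxClique {pair x y} pair-clique
    where
    pair-clique : IsClique (pair x y)
    pair-clique u∈ v∈ u≢v with ∈-pair⁻ u∈ | ∈-pair⁻ v∈
    ... | inj₁ refl | inj₁ refl = ⊥-elim (u≢v refl)
    ... | inj₁ refl | inj₂ refl = adjacent u≢v
    ... | inj₂ refl | inj₁ refl = adj-symmetric (adjacent (u≢v ∘ sym))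
    ... | inj₂ refl | inj₂ refl = ⊥-elim (u≢v refl)
  ... | M , maxM , pair⊆M = M , maxM , pair⊆M (∈-insert⁺ (replicate n false [ x ]≔ true) y (∈-insert-self (replicate n false) x)) ,
    pair⊆M (∈-insert-self (replicate n false [ x ]≔ true) y)

  vertex-in-maxClique : ∀ x → Σ (Sub n) λ M → IsMaxClique M × x ∈ₛ M
  vertex-in-maxClique x with maxClique-containing x x (λ x≢x → ⊥-elim (x≢x refl))
  ... | M , maxM , x∈M , _ = M , maxM , x∈M

  inAllMax-universal : ∀ {x} → T (inAllMax G x) → Universal (toGraph G) x
  inAllMax-universal core {y} x≢y with vertex-in-maxClique y
  ... | M , maxM , y∈M = proj₁ maxM (to T-inAllMax core maxM) y∈M x≢y

Core : ∀ {n} → FinGraph n → Set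
Core {n} G = Σ (Fin n) (T ∘ inAllMax G)

core↔Fin : ∀ {n} (G : FinGraph n) → Core G ↔ Fin (interSize G)
core↔Fin {n} G = Σ-T-tabulate↔ n (λ x → x) (inAllMax G)

maxClique↔Fin : ∀ {n} (G : FinGraph n) → MaxClique G ↔ Fin (numMaxCliques G)
maxClique↔Fin {n} G = Σ-T-allSubs↔ n (isMaxClique G)

module TrunkSquare {n} (G : FinGraph n) where
  open Cliques G

  clique-noncore-adj² : (Q : MaxClique G) (v : NonCore G) → E (Square (Trunk G)) (inj₁ Q) (inj₂ v)
  clique-noncore-adj² (Q , _) (v , _) with T? (v ∈ᵇ Q)
  ... | yes v∈Q = inj₁ v∈Q
  ... | no v∉Q with vertex-in-maxClique v
  ...   | M , maxM , v∈M =
    inj₂ ((λ ()) , v∉Q , inj₁ (M , from T-isMaxClique maxM) , (λ Q≡M → v∉Q (subst (v ∈ₛ_) (sym Q≡M) v∈M)) , v∈M)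

  clique-vertex-universal : (Q : MaxClique G) → Universal (Square (Trunk G)) (inj₁ Q)
  clique-vertex-universal Q {inj₁ Q'} Q≢Q' = inj₁ (λ Q≡Q' → Q≢Q' (cong inj₁ (Σ-T-≡ Q≡Q')))
  clique-vertex-universal Q {inj₂ v} _ = clique-noncore-adj² Q v

  noncore-adj⇔ : (v w : NonCore G) → Adj (proj₁ v) (proj₁ w) ⇔ E (Square (Trunk G)) (inj₂ v) (inj₂ w)
  noncore-adj⇔ v@(x , _) w@(y , _) = mk⇔ shared-clique adjacent-in-shared
    where
    shared-clique : Adj x y → E (Square (Trunk G)) (inj₂ v) (inj₂ w)
    shared-clique xy with maxClique-containing x y (λ _ → xy)
    ... | M , maxM , x∈M , y∈M =
      inj₂ ((λ { refl → adj⇒≢ xy refl }) , (λ ()) , inj₁ (M , from T-isMaxClique maxM) , x∈M , y∈M)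
    adjacent-in-shared : E (Square (Trunk G)) (inj₂ v) (inj₂ w) → Adj x y
    adjacent-in-shared (inj₁ ())
    adjacent-in-shared (inj₂ (v≢w , _ , inj₁ (M , maxM) , x∈M , y∈M)) =
      proj₁ (to T-isMaxClique maxM) x∈M y∈M (λ x≡y → v≢w (cong inj₂ (Σ-T-≡ x≡y)))
    adjacent-in-shared (inj₂ (_ , _ , inj₂ _ , () , _))

  module _ (cliques≤core : numMaxCliques G ≤ interSize G) where

    r : ℕ
    r = interSize G ∸ numMaxCliques G

    SquareJoin : Graph
    SquareJoin = Square (Trunk G) ⊕ K r

    -- The only use of the hypothesis: it leaves room for one core vertex per maximal clique.
    core↔ : Core G ↔ (MaxClique G ⊎ Fin r)
    core↔ = ↔-trans (core↔Fin G)
      (↔-trans (Fin-cong (sym (m+[n∸m]≡n cliques≤core))) (↔-trans +↔⊎ (↔-sym (maxClique↔Fin G) ⊎-↔ ↔-refl)))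

    regroup : ((MaxClique G ⊎ Fin r) ⊎ NonCore G) ↔ V SquareJoin
    regroup = mk↔ₛ′
      (λ { (inj₁ (inj₁ Q)) → inj₁ (inj₁ Q) ; (inj₁ (inj₂ i)) → inj₂ i ; (inj₂ v) → inj₁ (inj₂ v) })
      (λ { (inj₁ (inj₁ Q)) → inj₁ (inj₁ Q) ; (inj₂ i) → inj₁ (inj₂ i) ; (inj₁ (inj₂ v)) → inj₂ v })
      (λ { (inj₁ (inj₁ Q)) → refl ; (inj₂ i) → refl ; (inj₁ (inj₂ v)) → refl })
      (λ { (inj₁ (inj₁ Q)) → refl ; (inj₁ (inj₂ i)) → refl ; (inj₂ v) → refl })

    regrouped-universal : ∀ w → Universal SquareJoin (Inverse.to regroup (inj₁ w))
    regrouped-universal (inj₁ Q) = ⊕-universalˡ {B = K r} (clique-vertex-universal Q)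
    regrouped-universal (inj₂ i) = ⊕-universalʳ {A = Square (Trunk G)} (K-universal i)

    place : (Core G ⊎ NonCore G) ↔ V SquareJoin
    place = ↔-trans (core↔ ⊎-↔ ↔-refl) regroup

    σ : Fin n ↔ V SquareJoin
    σ = ↔-trans (↔-partition (inAllMax G)) place

    σ-core : ∀ {x} (t : T (inAllMax G x)) → Universal SquareJoin (Inverse.to σ x)
    σ-core {x} t = subst (Universal SquareJoin)
      (cong (Inverse.to place) (sym (partition-yes (inAllMax G) t)))
      (regrouped-universal (Inverse.to core↔ (x , t)))

    σ-noncore : ∀ {x} (f : T (not (inAllMax G x))) → Inverse.to σ x ≡ inj₁ (inj₂ (x , f))
    σ-noncore f = cong (Inverse.to place) (partition-no (inAllMax G) f)

    trunk-square-join : toGraph G ≅ SquareJoin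
    trunk-square-join = ≅-from-↔ σ (adjacency-via-universal
      (toGraph-simple G) (⊕-simple (square-simple (Trunk-simple G)) (K-simple r))
      (Inverse.to σ) (Injection.injective (↔⇒↣ σ)) (inAllMax G)
      (λ core → inAllMax-universal core , σ-core core) noncore)
      where
      noncore : ∀ {x y} → T (not (inAllMax G x)) → T (not (inAllMax G y)) →
                Adj x y ⇔ E SquareJoin (Inverse.to σ x) (Inverse.to σ y)
      noncore {x} {y} fx fy = subst₂ (λ a b → Adj x y ⇔ E SquareJoin a b)
        (sym (σ-noncore fx)) (sym (σ-noncore fy)) (noncore-adj⇔ (x , fx) (y , fy))

-- Part (b): squares of 3-sun-free split graphs

square-adj-of-path : ∀ {A x y z} → Dec (E A x y) → x ≢ y → E A x z → E A z y → E (Square A) x y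
square-adj-of-path (yes xy) _ _ _ = inj₁ xy
square-adj-of-path (no ¬xy) x≢y xz zy = inj₂ (x≢y , ¬xy , _ , xz , zy)

sun3-twinFree : TwinFree Sun3
sun3-twinFree {i} {j} same =
  toWitness {a? = i ≟ᶠ j} (to T-⇒ᵇ (to (T-allV {p = distinguished i}) (to (T-allV {p = λ i → allV (distinguished i)}) all-distinguished i) j)
                                  (from T-==ˢ (tabulate-cong (T-injective ∘ same))))
  where
  neighbourhood : Fin 6 → Sub 6
  neighbourhood i = tabulateᵛ λ j → sunEdge (toℕ i) (toℕ j) ∨ sunEdge (toℕ j) (toℕ i)
  distinguished : Fin 6 → Fin 6 → Bool
  distinguished i j = (neighbourhood i ==ˢ neighbourhood j) ⇒ᵇ ⌊ i ≟ᶠ j ⌋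
  all-distinguished : T (allV λ i → allV (distinguished i))
  all-distinguished = tt

module SplitGraph {m} (H : FinGraph m) (C : Sub m)
  (C-clique : ∀ {x y} → x ∈ₛ C → y ∈ₛ C → x ≢ y → T (adj H x y))
  (I-independent : ∀ {x y} → x ∉ₛ C → y ∉ₛ C → ¬ T (adj H x y)) where

  open Cliques H using (Adj; adj-symmetric; adj⇒≢)

  CliqueNeighbour : List (Fin m) → Set
  CliqueNeighbour L = Σ (Fin m) λ c → c ∈ₛ C × All (λ x → Adj x c) L

  star : Fin m → Sub m
  star c = tabulateᵛ λ x → (x ∈ᵇ C) ∨ adj H x c

  ∈-star⇔ : ∀ {c x} → x ∈ₛ star c ⇔ (x ∈ₛ C ⊎ Adj x c)
  ∈-star⇔ {c} {x} = ⇔.trans (mk⇔ (subst T lookup-star) (subst T (sym lookup-star))) T-∨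
    where
    lookup-star : lookup (star c) x ≡ (x ∈ᵇ C) ∨ adj H x c
    lookup-star = lookup∘tabulate _ x

  sun-embedding : ∀ {u₁ u₂ u₃ v₁ v₂ v₃} →
    u₁ ∉ₛ C → u₂ ∉ₛ C → u₃ ∉ₛ C → v₁ ∈ₛ C → v₂ ∈ₛ C → v₃ ∈ₛ C →
    Adj u₁ v₁ → Adj u₁ v₂ → ¬ Adj u₁ v₃ →
    Adj u₂ v₂ → Adj u₂ v₃ → ¬ Adj u₂ v₁ →
    Adj u₃ v₃ → Adj u₃ v₁ → ¬ Adj u₃ v₂ →
    InducedSubgraph Sun3 (toGraph H)
  sun-embedding {u₁} {u₂} {u₃} {v₁} {v₂} {v₃} u₁∉C u₂∉C u₃∉C v₁∈C v₂∈C v₃∈C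
                u₁v₁ u₁v₂ ¬u₁v₃ u₂v₂ u₂v₃ ¬u₂v₁ u₃v₃ u₃v₁ ¬u₃v₂ =
    twinFree-embedding {B = toGraph H} sun3-twinFree f adj⇔
    where
    f : Fin 6 → Fin m
    f 0F = u₁
    f 1F = u₂
    f 2F = u₃
    f 3F = v₁
    f 4F = v₂
    f 5F = v₃

    edge : ∀ {x y} → Adj x y → ⊤ ⇔ Adj x y
    edge xy = mk⇔ (λ _ → xy) _

    non-edge : ∀ {x y} → ¬ Adj x y → ⊥ ⇔ Adj x y
    non-edge ¬xy = mk⇔ (λ ()) ¬xy

    loop : ∀ {x} → ⊥ ⇔ Adj x x
    loop = non-edge λ xx → adj⇒≢ xx refl

    independent : ∀ {x y} → x ∉ₛ C → y ∉ₛ C → ⊥ ⇔ Adj x y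
    independent x∉C y∉C = non-edge (I-independent x∉C y∉C)

    clique : ∀ {x y} → x ∈ₛ C → y ∈ₛ C → x ≢ y → ⊤ ⇔ Adj x y
    clique x∈C y∈C x≢y = edge (C-clique x∈C y∈C x≢y)

    flipped : ∀ {A : Set} {x y} → A ⇔ Adj x y → A ⇔ Adj y x
    flipped a⇔xy = ⇔.trans a⇔xy (mk⇔ adj-symmetric adj-symmetric)

    v₁≢v₂ : v₁ ≢ v₂
    v₁≢v₂ refl = ¬u₃v₂ u₃v₁
    v₂≢v₃ : v₂ ≢ v₃
    v₂≢v₃ refl = ¬u₁v₃ u₁v₂
    v₁≢v₃ : v₁ ≢ v₃
    v₁≢v₃ refl = ¬u₂v₁ u₂v₃

    adj⇔ : ∀ i j → E Sun3 i j ⇔ Adj (f i) (f j)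
    adj⇔ 0F 0F = loop
    adj⇔ 0F 1F = independent u₁∉C u₂∉C
    adj⇔ 0F 2F = independent u₁∉C u₃∉C
    adj⇔ 0F 3F = edge u₁v₁
    adj⇔ 0F 4F = edge u₁v₂
    adj⇔ 0F 5F = non-edge ¬u₁v₃
    adj⇔ 1F 1F = loop
    adj⇔ 1F 2F = independent u₂∉C u₃∉C
    adj⇔ 1F 3F = non-edge ¬u₂v₁
    adj⇔ 1F 4F = edge u₂v₂
    adj⇔ 1F 5F = edge u₂v₃
    adj⇔ 2F 2F = loop
    adj⇔ 2F 3F = edge u₃v₁
    adj⇔ 2F 4F = non-edge ¬u₃v₂
    adj⇔ 2F 5F = edge u₃v₃
    adj⇔ 3F 3F = loop
    adj⇔ 3F 4F = clique v₁∈C v₂∈C v₁≢v₂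
    adj⇔ 3F 5F = clique v₁∈C v₃∈C v₁≢v₃
    adj⇔ 4F 4F = loop
    adj⇔ 4F 5F = clique v₂∈C v₃∈C v₂≢v₃
    adj⇔ 5F 5F = loop
    adj⇔ 1F 0F = flipped (adj⇔ 0F 1F)
    adj⇔ 2F 0F = flipped (adj⇔ 0F 2F)
    adj⇔ 2F 1F = flipped (adj⇔ 1F 2F)
    adj⇔ 3F 0F = flipped (adj⇔ 0F 3F)
    adj⇔ 3F 1F = flipped (adj⇔ 1F 3F)
    adj⇔ 3F 2F = flipped (adj⇔ 2F 3F)
    adj⇔ 4F 0F = flipped (adj⇔ 0F 4F)
    adj⇔ 4F 1F = flipped (adj⇔ 1F 4F)
    adj⇔ 4F 2F = flipped (adj⇔ 2F 4F)
    adj⇔ 4F 3F = flipped (adj⇔ 3F 4F)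
    adj⇔ 5F 0F = flipped (adj⇔ 0F 5F)
    adj⇔ 5F 1F = flipped (adj⇔ 1F 5F)
    adj⇔ 5F 2F = flipped (adj⇔ 2F 5F)
    adj⇔ 5F 3F = flipped (adj⇔ 3F 5F)
    adj⇔ 5F 4F = flipped (adj⇔ 4F 5F)

module SquareOfSplit {m} (H G : FinGraph m) (C : Sub m)
  (C-clique : ∀ {x y} → x ∈ₛ C → y ∈ₛ C → x ≢ y → T (adj H x y))
  (I-independent : ∀ {x y} → x ∉ₛ C → y ∉ₛ C → ¬ T (adj H x y))
  {c₀ : Fin m} (c₀∈C : c₀ ∈ₛ C)
  (connected : ∀ x y → Reach H x y)
  (sunFree : SunFree H)
  (square : ∀ x y → T (adj G x y) ⇔ E (Square (toGraph H)) x y) where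

  open SplitGraph H C C-clique I-independent
  open Cliques H using (Adj; adj-symmetric; adj⇒≢)
  open Cliques G using (IsMaxClique; maxClique-absorbs; T-isMaxClique; T-inAllMax)
    renaming (Adj to Adjᴳ; adj-symmetric to adjᴳ-symmetric)

  clique-neighbour : ∀ {x} → x ∉ₛ C → Σ (Fin m) λ c → c ∈ₛ C × Adj x c
  clique-neighbour {x} x∉C with connected c₀ x
  ... | here = ⊥-elim (x∉C c₀∈C)
  ... | step {z} _ zx with T? (z ∈ᵇ C)
  ...   | yes z∈C = z , z∈C , adj-symmetric zx
  ...   | no z∉C = ⊥-elim (I-independent z∉C x∉C zx)

  clique-vertex-universal : ∀ {c} → c ∈ₛ C → Universal (toGraph G) c
  clique-vertex-universal {c} c∈C {y} c≢y with T? (y ∈ᵇ C)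
  ... | yes y∈C = from (square c y) (inj₁ (C-clique c∈C y∈C c≢y))
  ... | no y∉C with clique-neighbour y∉C
  ...   | z , z∈C , yz with z ≟ᶠ c
  ...     | yes refl = from (square c y) (inj₁ (adj-symmetric yz))
  ...     | no z≢c = from (square c y)
    (square-adj-of-path (T? (adj H c y)) c≢y (C-clique c∈C z∈C (z≢c ∘ sym)) (adj-symmetric yz))

  independent-adj⇔ : ∀ {x y} → x ≢ y → x ∉ₛ C → y ∉ₛ C → Adjᴳ x y ⇔ CliqueNeighbour (x ∷ y ∷ [])
  independent-adj⇔ {x} {y} x≢y x∉C y∉C = mk⇔ common-neighbour adjacent
    where
    common-neighbour : Adjᴳ x y → CliqueNeighbour (x ∷ y ∷ [])
    common-neighbour xy with to (square x y) xy
    ... | inj₁ xyᴴ = ⊥-elim (I-independent x∉C y∉C xyᴴ)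
    ... | inj₂ (_ , _ , z , xz , zy) with T? (z ∈ᵇ C)
    ...   | yes z∈C = z , z∈C , xz ∷ adj-symmetric zy ∷ []
    ...   | no z∉C = ⊥-elim (I-independent x∉C z∉C xz)
    adjacent : CliqueNeighbour (x ∷ y ∷ []) → Adjᴳ x y
    adjacent (_ , _ , xc ∷ yc ∷ []) =
      from (square x y) (square-adj-of-path (T? (adj H x y)) x≢y xc (adj-symmetric yc))

  -- Three witnesses for the sublists missing one of x, y, z that all fail to extend span a 3-sun.
  module Helly (P : Fin m → Set) (P⇒I : ∀ {x} → P x → x ∉ₛ C)
               (pairwise : ∀ {x y} → P x → P y → CliqueNeighbour (x ∷ y ∷ [])) where

    helly₂ : ∀ R {x y} → All P (x ∷ y ∷ R) → CliqueNeighbour (x ∷ y ∷ R)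
    helly₂ [] (px ∷ py ∷ []) = pairwise px py
    helly₂ (z ∷ R) {x} {y} (px ∷ py ∷ pz ∷ pR)
      with helly₂ R (py ∷ pz ∷ pR) | helly₂ R (px ∷ pz ∷ pR) | helly₂ R (px ∷ py ∷ pR)
    ... | a , a∈C , ya ∷ za ∷ Ra | b , b∈C , xb ∷ zb ∷ Rb | c , c∈C , xc ∷ yc ∷ Rc
      with T? (adj H x a) | T? (adj H y b) | T? (adj H z c)
    ... | yes xa | _ | _ = a , a∈C , xa ∷ ya ∷ za ∷ Ra
    ... | no _ | yes yb | _ = b , b∈C , xb ∷ yb ∷ zb ∷ Rb
    ... | no _ | no _ | yes zc = c , c∈C , xc ∷ yc ∷ zc ∷ Rc
    ... | no ¬xa | no ¬yb | no ¬zc = ⊥-elim (sunFree (sun-embedding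
          (P⇒I px) (P⇒I py) (P⇒I pz) b∈C c∈C a∈C xb xc ¬xa yc ya ¬yb za zb ¬zc))

    helly : ∀ {L} → All P L → CliqueNeighbour L
    helly [] = c₀ , c₀∈C , []
    helly (px ∷ []) with pairwise px px
    ... | c , c∈C , xc ∷ _ = c , c∈C , xc ∷ []
    helly (px ∷ py ∷ pR) = helly₂ _ (px ∷ py ∷ pR)

  module Centre {Q} (maxQ : IsMaxClique Q) where

    InQ : Fin m → Set
    InQ x = x ∈ₛ Q × x ∉ₛ C

    pairwise : ∀ {x y} → InQ x → InQ y → CliqueNeighbour (x ∷ y ∷ [])
    pairwise {x} {y} (x∈Q , x∉C) (y∈Q , y∉C) with x ≟ᶠ y
    ... | yes refl = let c , c∈C , xc = clique-neighbour x∉C in c , c∈C , xc ∷ xc ∷ []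
    ... | no x≢y = to (independent-adj⇔ x≢y x∉C y∉C) (proj₁ maxQ x∈Q y∈Q x≢y)

    inQ? : ∀ x → Dec (InQ x)
    inQ? x = T? (x ∈ᵇ Q) ×-dec ¬? (T? (x ∈ᵇ C))

    centred : CliqueNeighbour (filter inQ? (allFin m))
    centred = Helly.helly InQ proj₂ pairwise (All.tabulate (proj₂ ∘ ∈-filter⁻ inQ? {xs = allFin m}))

    centre : Fin m
    centre = proj₁ centred

    centre∈C : centre ∈ₛ C
    centre∈C = proj₁ (proj₂ centred)

    centre-adj : ∀ {x} → x ∈ₛ Q → x ∉ₛ C → Adj x centre
    centre-adj x∈Q x∉C = All.lookup (proj₂ (proj₂ centred)) (∈-filter⁺ inQ? (∈-allFin _) (x∈Q , x∉C))

    C⊆Q : C ⊆ₛ Q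
    C⊆Q c∈C = maxClique-absorbs maxQ (λ _ → clique-vertex-universal c∈C)

    centre-neighbour∈Q : ∀ {x} → x ∉ₛ C → Adj x centre → x ∈ₛ Q
    centre-neighbour∈Q {x} x∉C x-centre = maxClique-absorbs maxQ adjacent
      where
      adjacent : ∀ {y} → y ∈ₛ Q → x ≢ y → Adjᴳ x y
      adjacent {y} y∈Q x≢y with T? (y ∈ᵇ C)
      ... | yes y∈C = adjᴳ-symmetric (clique-vertex-universal y∈C (x≢y ∘ sym))
      ... | no y∉C = from (independent-adj⇔ x≢y x∉C y∉C) (centre , centre∈C , x-centre ∷ centre-adj y∈Q y∉C ∷ [])

    Q≡star : Q ≡ star centre
    Q≡star = Sub-ext λ x → ⇔.trans (mk⇔ classify unclassify) (⇔.sym ∈-star⇔)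
      where
      classify : ∀ {x} → x ∈ₛ Q → x ∈ₛ C ⊎ Adj x centre
      classify {x} x∈Q with T? (x ∈ᵇ C)
      ... | yes x∈C = inj₁ x∈C
      ... | no x∉C = inj₂ (centre-adj x∈Q x∉C)
      unclassify : ∀ {x} → x ∈ₛ C ⊎ Adj x centre → x ∈ₛ Q
      unclassify (inj₁ x∈C) = C⊆Q x∈C
      unclassify {x} (inj₂ x-centre) with T? (x ∈ᵇ C)
      ... | yes x∈C = C⊆Q x∈C
      ... | no x∉C = centre-neighbour∈Q x∉C x-centre

  centreOf : MaxClique G → Fin m
  centreOf (_ , t) = Centre.centre (to T-isMaxClique t)

  centreOf∈C : ∀ Q → centreOf Q ∈ₛ C
  centreOf∈C (_ , t) = Centre.centre∈C (to T-isMaxClique t)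

  centreOf-injective : Injective _≡_ _≡_ centreOf
  centreOf-injective {Q , t} {Q' , t'} same-centre = Σ-T-≡
    (trans (Centre.Q≡star (to T-isMaxClique t)) (trans (cong star same-centre) (sym (Centre.Q≡star (to T-isMaxClique t')))))

  C⊆core : ∀ {c} → c ∈ₛ C → T (inAllMax G c)
  C⊆core c∈C = from T-inAllMax λ maxQ → Centre.C⊆Q maxQ c∈C

  noncore∉C : ∀ {v} → T (not (inAllMax G v)) → v ∉ₛ C
  noncore∉C noncore v∈C = to T-not⇔¬ noncore (C⊆core v∈C)

  embed : V (Trunk G) → Fin m
  embed (inj₁ Q) = centreOf Q
  embed (inj₂ v) = proj₁ v

  embed-injective : ∀ a b → embed a ≡ embed b → a ≡ b
  embed-injective (inj₁ Q) (inj₁ Q') e = cong inj₁ (centreOf-injective e)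
  embed-injective (inj₁ Q) (inj₂ (v , noncore)) e = ⊥-elim (noncore∉C noncore (subst (_∈ₛ C) e (centreOf∈C Q)))
  embed-injective (inj₂ (v , noncore)) (inj₁ Q) e = ⊥-elim (noncore∉C noncore (subst (_∈ₛ C) (sym e) (centreOf∈C Q)))
  embed-injective (inj₂ v) (inj₂ w) e = cong inj₂ (Σ-T-≡ e)

  embed-adj⇔ : ∀ a b → E (Trunk G) a b ⇔ Adj (embed a) (embed b)
  embed-adj⇔ (inj₁ Q) (inj₁ Q') =
    mk⇔ (λ Q≢Q' → C-clique (centreOf∈C Q) (centreOf∈C Q') (Q≢Q' ∘ cong proj₁ ∘ centreOf-injective))
        (λ adjacent Q≡Q' → adj⇒≢ adjacent (cong centreOf (Σ-T-≡ {a = Q} {Q'} Q≡Q')))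
  embed-adj⇔ (inj₁ (Q , t)) (inj₂ (v , noncore)) =
    mk⇔ (λ v∈Q → adj-symmetric (Centre.centre-adj (to T-isMaxClique t) v∈Q (noncore∉C noncore)))
        (λ adjacent → Centre.centre-neighbour∈Q (to T-isMaxClique t) (noncore∉C noncore) (adj-symmetric adjacent))
  embed-adj⇔ (inj₂ (v , noncore)) (inj₁ (Q , t)) =
    mk⇔ (λ v∈Q → Centre.centre-adj (to T-isMaxClique t) v∈Q (noncore∉C noncore))
        (Centre.centre-neighbour∈Q (to T-isMaxClique t) (noncore∉C noncore))
  embed-adj⇔ (inj₂ (v , noncore)) (inj₂ (w , noncore')) =
    mk⇔ (λ ()) (I-independent (noncore∉C noncore) (noncore∉C noncore'))

  trunk-induced : InducedSubgraph (Trunk G) (toGraph H)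
  trunk-induced = embed , embed-injective , embed-adj⇔

  centreCore : MaxClique G → Core G
  centreCore Q = centreOf Q , C⊆core (centreOf∈C Q)

  centreCore-injective : Injective _≡_ _≡_ centreCore
  centreCore-injective = centreOf-injective ∘ cong proj₁

  maxCliques≤core : numMaxCliques G ≤ interSize G
  maxCliques≤core = ↔-injective⇒≤ centreCore-injective (maxClique↔Fin G) (core↔Fin G)

  embed-surjective : interSize G ≡ numMaxCliques G → ∀ x → ∃ λ a → embed a ≡ x
  embed-surjective equal x with T-or-T-not (inAllMax G x)
  ... | inj₂ noncore = inj₂ (x , noncore) , refl
  ... | inj₁ core = inj₁ (proj₁ hit) , cong proj₁ (proj₂ hit)
    where
    hit : ∃ λ Q → centreCore Q ≡ (x , core)
    hit = ↔-injective⇒surjective centreCore-injective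
            (maxClique↔Fin G) (subst (λ k → Core G ↔ Fin k) equal (core↔Fin G)) (x , core)

  trunk-iso : interSize G ≡ numMaxCliques G → toGraph H ≅ Trunk G
  trunk-iso equal = surjective-embedding⇒≅ trunk-induced (embed-surjective equal)

-- In a connected split graph with an empty clique side there are no edges, hence only one
-- vertex, which may as well form the clique side.
clique-side-nonempty : ∀ {m} {H : FinGraph m} → Connected H → IsSplit H →
                       Σ (IsSplit H) λ split → ∃ λ c → c ∈ₛ proj₁ split
clique-side-nonempty {zero} (() , _)
clique-side-nonempty {suc m} {H} (_ , connected) split@(C , _ , independent) with any? (λ x → T? (x ∈ᵇ C))
... | yes nonempty = split , nonempty
... | no empty = (full , single-vertex , vacuous) , zero , tt
  where
  full : Sub (suc m)
  full = replicate (suc m) true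
  all-I : ∀ x → T (not (x ∈ᵇ C))
  all-I x = from T-not⇔¬ λ x∈C → empty (x , x∈C)
  walk-trivial : ∀ {x y} → Reach H x y → x ≡ y
  walk-trivial here = refl
  walk-trivial (step {y} {z} _ yz) = ⊥-elim (independent y z (all-I y) (all-I z) yz)
  single-vertex : ∀ x y → x ∈ₛ full → y ∈ₛ full → x ≢ y → T (adj H x y)
  single-vertex x y _ _ x≢y = ⊥-elim (x≢y (walk-trivial (connected x y)))
  vacuous : ∀ x y → T (not (x ∈ᵇ full)) → T (not (y ∈ᵇ full)) → ¬ T (adj H x y)
  vacuous x _ x∉ = ⊥-elim (subst (T ∘ not) (lookup-replicate x true) x∉)

trunk-square-join : ∀ (n : ℕ) (G : FinGraph n) → numMaxCliques G ≤ interSize G →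
                    toGraph G ≅ (Square (Trunk G) ⊕ K (interSize G ∸ numMaxCliques G))
trunk-square-join n G = TrunkSquare.trunk-square-join G

square-of-split : ∀ (m : ℕ) (H : FinGraph m) (G : FinGraph m) →
  IsSplit H → Connected H → SunFree H →
  (∀ x y → T (adj G x y) ⇔ E (Square (toGraph H)) x y) →
  (numMaxCliques G ≤ interSize G)
  × InducedSubgraph (Trunk G) (toGraph H)
  × (interSize G ≡ numMaxCliques G → toGraph H ≅ Trunk G)
square-of-split m H G split connected sunFree square
  with clique-side-nonempty connected split
... | (C , clique , independent) , _ , c₀∈C = maxCliques≤core , trunk-induced , trunk-iso
  where
  open SquareOfSplit H G C (λ {x} {y} → clique x y)
    (λ {x} {y} x∉C y∉C → independent x y (from T-not⇔¬ x∉C) (from T-not⇔¬ y∉C))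
    c₀∈C (proj₂ connected) sunFree square

lemma1 :
  (∀ (n : ℕ) (G : FinGraph n) →
    numMaxCliques G ≤ interSize G →
    toGraph G ≅ (Square (Trunk G) ⊕ K (interSize G ∸ numMaxCliques G)))
  ×
  (∀ (m : ℕ) (H : FinGraph m) (G : FinGraph m) →
    IsSplit H → Connected H → SunFree H →
    (∀ x y → T (adj G x y) ⇔ E (Square (toGraph H)) x y) →
    (numMaxCliques G ≤ interSize G)
    × InducedSubgraph (Trunk G) (toGraph H)
    × (interSize G ≡ numMaxCliques G → toGraph H ≅ Trunk G))
lemma1 = trunk-square-join , square-of-split
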